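{- Let $\mathtt{PAL}$ be the set of palindromic numbers (positive integers whose base-$2$ representation reads the same forwards and backwards). Then the quotient set $\mathtt{PAL}/\mathtt{PAL} = \{a/b : a, b \in \mathtt{PAL}\}$ is dense in the positive real numbers.
   Context: For a positive integer $n$, its base-$2$ representation is the binary string of $n$ starting with the most significant digit, which is $1$ (no leading zeros).
   Formalization: The open intervals in which some $a/b$ is found have rational endpoints rather than arbitrary endpoints among the positive real numbers. -}

module Defs where

open import Data.Nat using (ℕ; zero; suc; _<_; >-nonZero)
open import Data.Nat.DivMod using (_/_; _%_)
open import Data.List using (List; []; _∷_; reverse)
open import Data.Product using (_×_)
open import Data.Integer using (+_)
open import Data.Rational using (ℚ) renaming (_/_ to _/ℚ_)
open import Relation.Binary.PropositionalEquality using (_≡_)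

-- Binary digits, least significant first, computed with fuel.
-- With fuel ≥ n (each step halves n), bitsFuel n n is the full
-- base-2 representation of n (no leading zeros; empty for 0).
bitsFuel : ℕ → ℕ → List ℕ
bitsFuel zero    _       = []
bitsFuel (suc f) zero    = []
bitsFuel (suc f) (suc m) = (suc m % 2) ∷ bitsFuel f (suc m / 2)

bits : ℕ → List ℕ
bits n = bitsFuel n n

Pal : ℕ → Set
Pal n = (0 < n) × (reverse (bits n) ≡ bits n)

ratio : (a b : ℕ) → 0 < b → ℚ
ratio a b b>0 = (+ a /ℚ b) {{>-nonZero b>0}}

{-# OPTIONS --safe #-}
module Submission where

-- For 0 ≤ p/q < r/s pick E = 2^(K+1) with K = (p + 2q)s, so that a step of 1/E is small
-- against the gap r/s − p/q, and let n = ⌊p(E+1)/q⌋.  Writing n + 1 in binary and appending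
-- its mirror image below it gives a palindrome a with T(n+1) ≤ a < T(n+2), where T = 2^N
-- and N is the length of n + 1 in binary; and b = 1 + TE, with binary digits 10…01, is a
-- palindrome as well, and p/q < (n+1)/(E+1) ≤ a/b < (n+2)/E ≤ r/s.

open import Defs
open import Data.Nat using (ℕ)
open import Data.Product using (Σ; _×_; proj₁; ∃; _,_)

module BinaryPalindromes where

  open import Data.Nat
  open import Data.Nat.Properties
  open import Data.Nat.DivMod
  open import Data.Nat.Tactic.RingSolver using (solve-∀)
  open import Data.List using (List; []; _∷_; _++_; _∷ʳ_; reverse; replicate; length)
  open import Data.List.Properties using (unfold-reverse; reverse-++; reverse-involutive; length-reverse)
  open import Data.List.Relation.Unary.All using (All; []; _∷_)
  open import Data.List.Relation.Unary.All.Properties using (replicate⁺)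
  open import Data.List.Relation.Binary.Permutation.Propositional using (↭-sym)
  open import Data.List.Relation.Binary.Permutation.Propositional.Properties using (All-resp-↭; ↭-reverse)
  open import Data.Product using (∃₂)
  open import Relation.Binary.PropositionalEquality
  open import Relation.Nullary using (contradiction)

  private variable
    A : Set
    d : ℕ
    ds : List ℕ

  n<2^n : ∀ n → n < 2 ^ n
  n<2^n zero    = z<s
  n<2^n (suc n) = begin-strict
    suc n            ≤⟨ n<2^n n ⟩
    2 ^ n            <⟨ m<m+n (2 ^ n) (m^n>0 2 n) ⟩
    2 ^ n + 2 ^ n    ≡⟨ cong (2 ^ n +_) (+-identityʳ (2 ^ n)) ⟨
    2 ^ suc n        ∎
    where open ≤-Reasoning

  m<[1+m/n]*n : ∀ m n .{{_ : NonZero n}} → m < suc (m / n) * n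
  m<[1+m/n]*n m n = begin-strict
    m                    ≡⟨ m≡m%n+[m/n]*n m n ⟩
    m % n + (m / n) * n  <⟨ +-monoˡ-< ((m / n) * n) (m%n<n m n) ⟩
    suc (m / n) * n      ∎
    where open ≤-Reasoning

  [m+kn]/n≡k : ∀ {m n} k .{{_ : NonZero n}} → m < n → (m + k * n) / n ≡ k
  [m+kn]/n≡k {m} {n} k m<n = begin
    (m + k * n) / n   ≡⟨ +-distrib-/ m (k * n) no-carry ⟩
    m / n + k * n / n ≡⟨ cong₂ _+_ (m<n⇒m/n≡0 m<n) (m*n/n≡m k n) ⟩
    k                 ∎
    where
    open ≡-Reasoning
    no-carry : m % n + k * n % n < n
    no-carry = subst₂ (λ u v → u + v < n) (sym (m<n⇒m%n≡m m<n)) (sym (m*n%n≡0 k n))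
                      (subst (_< n) (sym (+-identityʳ m)) m<n)

  All-reverse : ∀ {P : A → Set} {xs} → All P xs → All P (reverse xs)
  All-reverse {xs = xs} = All-resp-↭ (↭-sym (↭-reverse xs))

  replicate-∷ʳ : ∀ n (x : A) → replicate n x ∷ʳ x ≡ x ∷ replicate n x
  replicate-∷ʳ zero    x = refl
  replicate-∷ʳ (suc n) x = cong (x ∷_) (replicate-∷ʳ n x)

  reverse-replicate : ∀ n (x : A) → reverse (replicate n x) ≡ replicate n x
  reverse-replicate zero    x = refl
  reverse-replicate (suc n) x = begin
    reverse (x ∷ replicate n x)  ≡⟨ unfold-reverse x (replicate n x) ⟩
    reverse (replicate n x) ∷ʳ x ≡⟨ cong (_∷ʳ x) (reverse-replicate n x) ⟩
    replicate n x ∷ʳ x           ≡⟨ replicate-∷ʳ n x ⟩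
    x ∷ replicate n x            ∎
    where open ≡-Reasoning

  fromBits : List ℕ → ℕ
  fromBits []       = 0
  fromBits (d ∷ ds) = d + fromBits ds * 2

  data Canonical : List ℕ → Set where
    [1] : Canonical (1 ∷ [])
    _∷_ : d < 2 → Canonical ds → Canonical (d ∷ ds)

  Canonical⇒All : Canonical ds → All (_< 2) ds
  Canonical⇒All [1]       = s<s z<s ∷ []
  Canonical⇒All (d<2 ∷ c) = d<2 ∷ Canonical⇒All c

  Canonical-++ : ∀ {xs ys} → All (_< 2) xs → Canonical ys → Canonical (xs ++ ys)
  Canonical-++ []          c = c
  Canonical-++ (d<2 ∷ bs) c = d<2 ∷ Canonical-++ bs c

  increment : List ℕ → List ℕ
  increment []           = 1 ∷ []
  increment (zero  ∷ ds) = 1 ∷ ds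
  increment (suc _ ∷ ds) = 0 ∷ increment ds

  Canonical-increment : Canonical ds → Canonical (increment ds)
  Canonical-increment [1]           = z<s ∷ [1]
  Canonical-increment (z<s ∷ c)     = s<s z<s ∷ c
  Canonical-increment (s<s z<s ∷ c) = z<s ∷ Canonical-increment c

  fromBits-increment : Canonical ds → fromBits (increment ds) ≡ suc (fromBits ds)
  fromBits-increment [1]           = refl
  fromBits-increment (z<s ∷ c)     = refl
  fromBits-increment (s<s z<s ∷ c) = cong (_* 2) (fromBits-increment c)

  binary-representation : ∀ n → ∃ λ ds → Canonical ds × fromBits ds ≡ suc n
  binary-representation zero = 1 ∷ [] , [1] , refl
  binary-representation (suc n) with binary-representation n
  ... | ds , c , ds≡ = increment ds , Canonical-increment c , trans (fromBits-increment c) (cong suc ds≡)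

  fromBits>0 : Canonical ds → 0 < fromBits ds
  fromBits>0 [1] = z<s
  fromBits>0 {d ∷ ds} (_ ∷ c) = ≤-trans (fromBits>0 c) (≤-trans (m≤m*n (fromBits ds) 2) (m≤n+m _ d))

  bitsFuel-zero : ∀ f → bitsFuel f 0 ≡ []
  bitsFuel-zero zero    = refl
  bitsFuel-zero (suc f) = refl

  bitsFuel-suc : ∀ f {n} → 0 < n → bitsFuel (suc f) n ≡ n % 2 ∷ bitsFuel f (n / 2)
  bitsFuel-suc f {suc n} _ = refl

  bitsFuel-fromBits : ∀ f → Canonical ds → fromBits ds ≤ f → bitsFuel f (fromBits ds) ≡ ds
  bitsFuel-fromBits zero    c   n≤0 = contradiction n≤0 (<⇒≱ (fromBits>0 c))
  bitsFuel-fromBits (suc f) [1] _   = cong (1 ∷_) (bitsFuel-zero f)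
  bitsFuel-fromBits {d ∷ ds} (suc f) (d<2 ∷ c) n≤1+f = begin
    bitsFuel (suc f) (d + v * 2)                    ≡⟨ bitsFuel-suc f (fromBits>0 (d<2 ∷ c)) ⟩
    (d + v * 2) % 2 ∷ bitsFuel f ((d + v * 2) / 2)
      ≡⟨ cong₂ (λ u w → u ∷ bitsFuel f w) low-digit ([m+kn]/n≡k v d<2) ⟩
    d ∷ bitsFuel f v                                ≡⟨ cong (d ∷_) (bitsFuel-fromBits f c v≤f) ⟩
    d ∷ ds                                          ∎
    where
    open ≡-Reasoning
    v = fromBits ds
    low-digit : (d + v * 2) % 2 ≡ d
    low-digit = trans ([m+kn]%n≡m%n d v 2) (m<n⇒m%n≡m d<2)
    v≤f : v ≤ f
    v≤f = ≤-pred (≤-trans (<-≤-trans (m<m*n v 2 {{>-nonZero (fromBits>0 c)}} (s<s z<s)) (m≤n+m _ d)) n≤1+f)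

  bits-fromBits : Canonical ds → bits (fromBits ds) ≡ ds
  bits-fromBits c = bitsFuel-fromBits _ c ≤-refl

  Pal-fromBits : Canonical ds → reverse ds ≡ ds → Pal (fromBits ds)
  Pal-fromBits c palindromic = fromBits>0 c , subst (λ l → reverse l ≡ l) (sym (bits-fromBits c)) palindromic

  fromBits-++ : ∀ xs ys → fromBits (xs ++ ys) ≡ fromBits xs + 2 ^ length xs * fromBits ys
  fromBits-++ []       ys = sym (+-identityʳ (fromBits ys))
  fromBits-++ (d ∷ xs) ys = trans (cong (λ v → d + v * 2) (fromBits-++ xs ys))
                                  (shift d (fromBits xs) (2 ^ length xs) (fromBits ys))
    where
    shift : ∀ d u t w → d + (u + t * w) * 2 ≡ d + u * 2 + 2 * t * w
    shift = solve-∀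

  fromBits-< : All (_< 2) ds → fromBits ds < 2 ^ length ds
  fromBits-< []                    = z<s
  fromBits-< {d ∷ ds} (d<2 ∷ bs) = begin-strict
    d + fromBits ds * 2    <⟨ +-monoˡ-< (fromBits ds * 2) d<2 ⟩
    suc (fromBits ds) * 2  ≤⟨ *-monoˡ-≤ 2 (fromBits-< bs) ⟩
    2 ^ length ds * 2      ≡⟨ *-comm (2 ^ length ds) 2 ⟩
    2 ^ suc (length ds)    ∎
    where open ≤-Reasoning

  palindrome-with-prefix : ∀ n → ∃₂ λ N a → Pal a × 2 ^ N * suc n ≤ a × a < 2 ^ N * suc (suc n)
  palindrome-with-prefix n with binary-representation n
  ... | ds , c , ds≡ = length ds , fromBits (rs ++ ds) , palindrome , lower , upper
    where
    open ≤-Reasoning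
    rs = reverse ds
    T = 2 ^ length ds
    rs-bits : All (_< 2) rs
    rs-bits = All-reverse (Canonical⇒All c)
    palindrome : Pal (fromBits (rs ++ ds))
    palindrome = Pal-fromBits (Canonical-++ rs-bits c)
                              (trans (reverse-++ rs ds) (cong (rs ++_) (reverse-involutive ds)))
    value : fromBits (rs ++ ds) ≡ fromBits rs + T * suc n
    value = trans (fromBits-++ rs ds) (cong₂ (λ N v → fromBits rs + 2 ^ N * v) (length-reverse ds) ds≡)
    rs<T : fromBits rs < T
    rs<T = subst (λ N → fromBits rs < 2 ^ N) (length-reverse ds) (fromBits-< rs-bits)
    lower : T * suc n ≤ fromBits (rs ++ ds)
    lower = begin
      T * suc n                ≤⟨ m≤n+m (T * suc n) (fromBits rs) ⟩
      fromBits rs + T * suc n  ≡⟨ value ⟨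
      fromBits (rs ++ ds)      ∎
    upper : fromBits (rs ++ ds) < T * suc (suc n)
    upper = begin-strict
      fromBits (rs ++ ds)      ≡⟨ value ⟩
      fromBits rs + T * suc n  <⟨ +-monoˡ-< (T * suc n) rs<T ⟩
      T + T * suc n            ≡⟨ *-suc T (suc n) ⟨
      T * suc (suc n)          ∎

  fromBits-0ᵏ1 : ∀ k → fromBits (replicate k 0 ++ 1 ∷ []) ≡ 2 ^ k
  fromBits-0ᵏ1 zero    = refl
  fromBits-0ᵏ1 (suc k) = trans (cong (_* 2) (fromBits-0ᵏ1 k)) (*-comm (2 ^ k) 2)

  Pal-1+2^[1+k] : ∀ k → Pal (1 + 2 ^ suc k)
  Pal-1+2^[1+k] k = subst Pal value (Pal-fromBits (s<s z<s ∷ Canonical-++ (replicate⁺ k z<s) [1]) palindromic)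
    where
    open ≡-Reasoning
    zs = replicate k 0
    value : fromBits (1 ∷ zs ++ 1 ∷ []) ≡ 1 + 2 ^ suc k
    value = cong suc (fromBits-0ᵏ1 (suc k))
    palindromic : reverse (1 ∷ zs ++ 1 ∷ []) ≡ 1 ∷ zs ++ 1 ∷ []
    palindromic = begin
      reverse (1 ∷ zs ++ 1 ∷ [])    ≡⟨ unfold-reverse 1 (zs ++ 1 ∷ []) ⟩
      reverse (zs ++ 1 ∷ []) ∷ʳ 1   ≡⟨ cong (_∷ʳ 1) (reverse-++ zs (1 ∷ [])) ⟩
      (1 ∷ reverse zs) ∷ʳ 1         ≡⟨ cong (λ l → (1 ∷ l) ∷ʳ 1) (reverse-replicate k 0) ⟩
      1 ∷ zs ++ 1 ∷ []              ∎

  -- p/q < m/(1 + E) ≤ Tm/(1 + TE) ≤ a/(1 + TE)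
  lower-cross-bound : ∀ p q m {a} T .{{_ : NonZero T}} E →
                      p * suc E < m * q → T * m ≤ a → p * (1 + T * E) < a * q
  lower-cross-bound p q m {a} T E pE<mq Tm≤a = begin-strict
    p * (1 + T * E)   ≤⟨ *-monoʳ-≤ p (+-monoˡ-≤ (T * E) (>-nonZero⁻¹ T)) ⟩
    p * (T + T * E)   ≡⟨ regroup p T E ⟩
    T * (p * suc E)   <⟨ *-monoʳ-< T pE<mq ⟩
    T * (m * q)       ≡⟨ *-assoc T m q ⟨
    T * m * q         ≤⟨ *-monoˡ-≤ q Tm≤a ⟩
    a * q             ∎
    where
    open ≤-Reasoning
    regroup : ∀ p T E → p * (T + T * E) ≡ T * (p * suc E)
    regroup = solve-∀

  -- a/(1 + TE) < Tm/(TE) = m/E ≤ r/s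
  upper-cross-bound : ∀ r s m {a} T E .{{_ : NonZero s}} →
                      a < T * m → m * s ≤ r * E → a * s < r * (1 + T * E)
  upper-cross-bound r s m {a} T E a<Tm ms≤rE = begin-strict
    a * s             <⟨ *-monoˡ-< s a<Tm ⟩
    T * m * s         ≡⟨ *-assoc T m s ⟩
    T * (m * s)       ≤⟨ *-monoʳ-≤ T ms≤rE ⟩
    T * (r * E)       ≡⟨ regroup r T E ⟩
    r * (T * E)       ≤⟨ m≤n+m (r * (T * E)) r ⟩
    r + r * (T * E)   ≡⟨ *-suc r (T * E) ⟨
    r * (1 + T * E)   ∎
    where
    open ≤-Reasoning
    regroup : ∀ r T E → T * (r * E) ≡ r * (T * E)
    regroup = solve-∀

  -- (n + 2)/E ≤ p/q + (p + 2q)/(qE) ≤ p/q + 1/(qs) ≤ r/s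
  two-steps-fit : ∀ p q r s n E .{{_ : NonZero q}} →
                  n * q ≤ p * suc E → p * s < r * q → p * s + 2 * q * s ≤ E →
                  suc (suc n) * s ≤ r * E
  two-steps-fit p q r s n E nq≤pE ps<rq budget = *-cancelˡ-≤ q (begin
    q * (suc (suc n) * s)             ≡⟨ expand₁ q n s ⟩
    (n * q + 2 * q) * s               ≤⟨ *-monoˡ-≤ s (+-monoˡ-≤ (2 * q) nq≤pE) ⟩
    (p * suc E + 2 * q) * s           ≡⟨ expand₂ p E q s ⟩
    p * s * E + (p * s + 2 * q * s)   ≤⟨ +-monoʳ-≤ (p * s * E) budget ⟩
    p * s * E + E                     ≡⟨ +-comm (p * s * E) E ⟩
    suc (p * s) * E                   ≤⟨ *-monoˡ-≤ E ps<rq ⟩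
    r * q * E                         ≡⟨ regroup r q E ⟩
    q * (r * E)                       ∎)
    where
    open ≤-Reasoning
    expand₁ : ∀ q n s → q * (suc (suc n) * s) ≡ (n * q + 2 * q) * s
    expand₁ = solve-∀
    expand₂ : ∀ p E q s → (p * suc E + 2 * q) * s ≡ p * s * E + (p * s + 2 * q * s)
    expand₂ = solve-∀
    regroup : ∀ r q E → r * q * E ≡ q * (r * E)
    regroup = solve-∀

  palindromic-fraction-between : ∀ p q r s .{{_ : NonZero q}} .{{_ : NonZero s}} → p * s < r * q →
    ∃₂ λ a b → Pal a × Pal b × p * b < a * q × a * s < r * b
  palindromic-fraction-between p q r s ps<rq =
    let N , a , pal-a , lower , upper = palindrome-with-prefix n
        T = 2 ^ N
        instance
          T≢0 : NonZero T
          T≢0 = m^n≢0 2 N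
        pal-b = subst (λ t → Pal (1 + t)) (2^[1+N+K]≡T*E N) (Pal-1+2^[1+k] (N + K))
    in a , 1 + T * E , pal-a , pal-b ,
       lower-cross-bound p q (suc n) T E (m<[1+m/n]*n (p * suc E) q) lower ,
       upper-cross-bound r s (suc (suc n)) T E upper
         (two-steps-fit p q r s n E (m/n*n≤m (p * suc E) q) ps<rq budget)
    where
    K = p * s + 2 * q * s
    E = 2 ^ suc K
    n = p * suc E / q
    2^[1+N+K]≡T*E : ∀ N → 2 ^ suc (N + K) ≡ 2 ^ N * E
    2^[1+N+K]≡T*E N = trans (cong (2 ^_) (sym (+-suc N K))) (^-distribˡ-+-* 2 N (suc K))
    budget : K ≤ E
    budget = <⇒≤ (<-trans (n<1+n K) (n<2^n (suc K)))

open BinaryPalindromes using (palindromic-fraction-between)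

open import Data.Nat as ℕ using (suc; z<s; >-nonZero)
open import Data.Integer as ℤ using (+_; -[1+_]; +<+)
open import Data.Integer.Properties using (pos-*; drop‿+<+)
open import Data.Rational using (ℚ; _<_; 0ℚ; mkℚ; _≤_; *≤*; toℚᵘ)
open import Data.Rational.Properties using (↥p/↧p≡p; toℚᵘ-mono-<; toℚᵘ-cancel-<; toℚᵘ-fromℚᵘ; <⇒≤; <-trans)
open import Data.Rational.Unnormalised as ℚᵘ using (mkℚᵘ; *<*)
import Data.Rational.Unnormalised.Properties as ℚᵘ
open import Function.Bundles using (_⇔_; mk⇔; Equivalence)
open import Relation.Binary.PropositionalEquality using (_≡_; refl; sym; subst₂)

mkℚᵘ<mkℚᵘ⇔ : ∀ a b c d → mkℚᵘ (+ a) b ℚᵘ.< mkℚᵘ (+ c) d ⇔ a ℕ.* suc d ℕ.< c ℕ.* suc b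
mkℚᵘ<mkℚᵘ⇔ a b c d = mk⇔
  (λ { (*<* lt) → drop‿+<+ (subst₂ ℤ._<_ (sym (pos-* a (suc d))) (sym (pos-* c (suc b))) lt) })
  (λ lt → *<* (subst₂ ℤ._<_ (pos-* a (suc d)) (pos-* c (suc b)) (+<+ lt)))

toℚᵘ-ratio : ∀ a b (b>0 : 0 ℕ.< b) → toℚᵘ (ratio a b b>0) ℚᵘ.≃ mkℚᵘ (+ a) (ℕ.pred b)
toℚᵘ-ratio a (suc b) _ = toℚᵘ-fromℚᵘ (mkℚᵘ (+ a) b)

ratio<ratio⇔ : ∀ a {b} (b>0 : 0 ℕ.< b) c {d} (d>0 : 0 ℕ.< d) →
               ratio a b b>0 < ratio c d d>0 ⇔ a ℕ.* d ℕ.< c ℕ.* b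
ratio<ratio⇔ a {b@(suc _)} b>0 c {d@(suc _)} d>0 = mk⇔
  (λ lt → Equivalence.to cross (ℚᵘ.<-respʳ-≃ c/d≃ (ℚᵘ.<-respˡ-≃ a/b≃ (toℚᵘ-mono-< lt))))
  (λ lt → toℚᵘ-cancel-< (ℚᵘ.<-respʳ-≃ (ℚᵘ.≃-sym c/d≃) (ℚᵘ.<-respˡ-≃ (ℚᵘ.≃-sym a/b≃) (Equivalence.from cross lt))))
  where
  cross = mkℚᵘ<mkℚᵘ⇔ a (ℕ.pred b) c (ℕ.pred d)
  a/b≃ = toℚᵘ-ratio a b b>0
  c/d≃ = toℚᵘ-ratio c d d>0

nonNegative⇒ratio : ∀ x → 0ℚ ≤ x → ∃ λ p → ∃ λ q → Σ (0 ℕ.< q) λ q>0 → ratio p q q>0 ≡ x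
nonNegative⇒ratio x@(mkℚ (+ p) q-1 _) _ = p , suc q-1 , z<s , ↥p/↧p≡p x
nonNegative⇒ratio (mkℚ -[1+ _ ] _ _) (*≤* ())

theorem2 : (x y : ℚ) → 0ℚ < x → x < y →
    Σ ℕ λ a → Σ ℕ λ b → Σ (Pal a) λ pa → Σ (Pal b) λ pb →
      (x < ratio a b (proj₁ pb)) × (ratio a b (proj₁ pb) < y)
theorem2 x y 0<x x<y
  with nonNegative⇒ratio x (<⇒≤ 0<x) | nonNegative⇒ratio y (<⇒≤ (<-trans 0<x x<y))
... | p , q , q>0 , refl | r , s , s>0 , refl
  with palindromic-fraction-between p q r s {{>-nonZero q>0}} {{>-nonZero s>0}}
         (Equivalence.to (ratio<ratio⇔ p q>0 r s>0) x<y)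
... | a , b , pal-a , pal-b , pb<aq , as<rb =
  a , b , pal-a , pal-b ,
  Equivalence.from (ratio<ratio⇔ p q>0 a (proj₁ pal-b)) pb<aq ,
  Equivalence.from (ratio<ratio⇔ a (proj₁ pal-b) r s>0) as<rb
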